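{- Let $\gamma$ be a scalar umbra provided with a compositional inverse. Let $\{q_n(x)=\sum_{k=0}^nq_{n,k}x^k\}$ be the polynomial sequence associated to $\gamma$ and $\{p_n(x)\}$ the polynomial sequence associated to $\gamma^{<-1>}$. Then these sequences are inverse to each other, in the sense that $$\sum_{k=0}^n q_{n,k}\,p_k(x)=x^n\quad\text{for all }n\ge0.$$
   Context: Classical umbral calculus over a commutative integral domain $R$ whose quotient field has characteristic $0$: umbrae are symbols with a linear evaluation $E$ ($E[1]=1$, multiplicative on products of powers of pairwise distinct umbrae); moments $E[\alpha^n]$, g.f. $f(\alpha,t)=\sum_nE[\alpha^n]t^n/n!$; $p\simeq q$ means $E[p]=E[q]$. Bell umbra $\beta$: g.f. $\exp(e^t-1)$. For a scalar $c$ (integer or indeterminate) $f(c.\alpha,t)=f(\alpha,t)^c$; for umbrae $f(\gamma.\alpha,t)=f(\gamma,\log f(\alpha,t))$. $\gamma$ is provided with a compositional inverse if $E[\gamma]\neq0$ and $f(\gamma,t)-1$ has a compositional inverse series $h_\gamma$; then $\gamma^{<-1>}$ is the umbra with g.f. $1+h_\gamma(t)$ and the adjoint $\gamma^*=\beta.\gamma^{<-1>}$ has g.f. $\exp(h_\gamma(t))$. A scalar umbra has moments in $R$. A polynomial sequence $\{p_n(x)\}$ is associated to $\gamma$ if $p_n(x)\simeq(x.\gamma^*)^n$ for all $n$, i.e. $\sum_np_n(x)t^n/n!=\exp(xh_\gamma(t))$. -}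

module Defs where

open import Level using (_⊔_)
open import Data.Nat using (ℕ; zero; suc)
open import Data.Nat.Combinatorics using (_C_)
open import Algebra.Bundles using (CommutativeRing)
open import Relation.Nullary using (¬_)
open import Relation.Binary.PropositionalEquality using (_≡_)
open import Data.Product using (Σ; _×_)

-- Everything is developed over an arbitrary commutative ring R (the paper's
-- integral-domain / characteristic-0 hypotheses are stated separately below).
module Umbral {c ℓ} (R : CommutativeRing c ℓ) where
  open CommutativeRing R

  IsIntegralDomain : Set (c ⊔ ℓ)
  IsIntegralDomain = (¬ (1# ≈ 0#)) × (∀ x y → x * y ≈ 0# → (x ≈ 0#) Data.Sum.⊎ (y ≈ 0#))
    where import Data.Sum

  fromℕ : ℕ → Carrier
  fromℕ zero    = 0#
  fromℕ (suc n) = 1# + fromℕ n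

  -- quotient field has characteristic 0 (for a domain: n·1 = 0 only for n = 0)
  CharZero : Set ℓ
  CharZero = ∀ n → fromℕ (suc n) ≈ 0# → Data.Empty.⊥
    where import Data.Empty

  sumTo : ℕ → (ℕ → Carrier) → Carrier
  sumTo zero    f = f 0
  sumTo (suc n) f = sumTo n f + f (suc n)

  -- Exponential formal power series: F represents Σ_n F n t^n / n!.
  -- A (scalar) umbra is represented by its moment sequence E[α^n];
  -- its generating function f(α,t) is the exponential series of the moments.
  ESeries : Set c
  ESeries = ℕ → Carrier

  -- f(α,t) - 1  (requires E[1] = 1)
  minus1 : ESeries → ESeries
  minus1 F zero    = 0#
  minus1 F (suc n) = F (suc n)

  plus1 : ESeries → ESeries
  plus1 H zero    = 1#
  plus1 H (suc n) = H (suc n)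

  tSeries : ESeries
  tSeries (suc zero) = 1#
  tSeries _          = 0#

  -- divPow k H = H(t)^k / k!  (as an exponential series), computed via
  -- d/dt (H^(k+1)/(k+1)!) = H'(t) · H^k/k!  and zero constant term (H 0 = 0).
  divPow : ℕ → ESeries → ESeries
  divPow zero    H zero    = 1#
  divPow zero    H (suc n) = 0#
  divPow (suc k) H zero    = 0#
  divPow (suc k) H (suc n) =
    sumTo n (λ i → fromℕ (n C i) * (H (suc i) * divPow k H (n Data.Nat.∸ i)))
    where import Data.Nat

  -- composition F(H(t)) for H with zero constant term:
  -- Σ_k F_k H^k/k!  (coefficient of t^n/n! only gets k ≤ n)
  compose : ESeries → ESeries → ESeries
  compose F H n = sumTo n (λ k → F k * divPow k H n)

  IsCompInverse : ESeries → ESeries → Set ℓ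
  IsCompInverse F H =
    (H 0 ≈ 0#) × ((∀ n → compose F H n ≈ tSeries n) × (∀ n → compose H F n ≈ tSeries n))

  -- A polynomial sequence {p_n(x)} is given by its coefficients:
  -- p n k = coefficient of x^k in p_n(x).
  PolySeq : Set c
  PolySeq = ℕ → ℕ → Carrier

  -- {p_n} is associated to the umbra with moments a:
  --   Σ_n p_n(x) t^n/n! = exp(x h(t)) = Σ_k x^k h(t)^k/k!,
  -- where h is the compositional inverse of f(α,t) - 1.
  IsAssociated : ESeries → PolySeq → Set (c ⊔ ℓ)
  IsAssociated a p =
    Σ ESeries (λ h → IsCompInverse (minus1 a) h × (∀ n k → p n k ≈ divPow k h n))

  -- Kronecker delta (coefficients of x^n)
  δ : ℕ → ℕ → Carrier
  δ zero    zero    = 1#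
  δ zero    (suc j) = 0#
  δ (suc n) zero    = 0#
  δ (suc n) (suc j) = δ n j

-- Write G^j/j! for divPow j G and F ∘ H for compose F H.  The coefficient
-- q n k is the t^n/n! coefficient of h^k/k! and p k j that of g^j/j!, where
-- g is the compositional inverse of h.  Hence Σ_k q n k · p k j is the
-- t^n/n! coefficient of (g^j/j!) ∘ h = (g ∘ h)^j/j! = t^j/j!, that is δ n j.
-- The middle equality holds because composition with h is a ring
-- homomorphism on exponential series, which in turn follows by strong
-- induction on the degree from the chain rule (F ∘ h)' = h' · (F' ∘ h).
module Submission where

open import Defs
open import Level using (_⊔_)
open import Data.Product using (_,_)
open import Data.Empty using (⊥-elim)
open import Data.Nat using (ℕ; zero; suc; _∸_; _≤_; _<_; _≤′_; z≤n; s≤s; ≤′-reflexive; ≤′-step)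
  renaming (_+_ to _+ℕ_)
open import Data.Nat.Properties
  using (≤-refl; ≤-<-trans; ≤-pred; m≤n⇒m≤1+n; n≤1+n; <⇒≢; ≤∧≢⇒<; ≤⇒≤′; ≤′⇒≤; +-∸-assoc; _≟_)
open import Data.Nat.Induction using (<-rec)
open import Data.Nat.Combinatorics using (_C_; nCk+nC[k+1]≡[n+1]C[k+1]; k>n⇒nCk≡0)
open import Relation.Nullary using (¬_; yes; no)
open import Algebra.Bundles using (CommutativeRing)
import Algebra.Properties.CommutativeSemigroup as CommutativeSemigroupProperties
import Relation.Binary.PropositionalEquality as ≡
import Relation.Binary.Reasoning.Setoid as SetoidReasoning

module ExponentialSeries {c ℓ} (R : CommutativeRing c ℓ) where
  open CommutativeRing R hiding (zero)
  open Umbral R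
  open SetoidReasoning setoid
  open CommutativeSemigroupProperties +-commutativeSemigroup using (interchange; x∙yz≈y∙xz)
  open CommutativeSemigroupProperties *-commutativeSemigroup using () renaming (x∙yz≈y∙xz to x*yz≈y*xz)

  sumTo-cong : ∀ n {f g : ℕ → Carrier} → (∀ k → k ≤ n → f k ≈ g k) → sumTo n f ≈ sumTo n g
  sumTo-cong zero    f≈g = f≈g 0 z≤n
  sumTo-cong (suc n) f≈g = +-cong (sumTo-cong n (λ k k≤n → f≈g k (m≤n⇒m≤1+n k≤n))) (f≈g (suc n) ≤-refl)

  sumTo-vanishing : ∀ n {f : ℕ → Carrier} → (∀ k → k ≤ n → f k ≈ 0#) → sumTo n f ≈ 0#
  sumTo-vanishing n f≈0 = trans (sumTo-cong n f≈0) (zeros n)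
    where
      zeros : ∀ n → sumTo n (λ _ → 0#) ≈ 0#
      zeros zero    = refl
      zeros (suc n) = trans (+-congʳ (zeros n)) (+-identityʳ 0#)

  sumTo-distrib-+ : ∀ n (f g : ℕ → Carrier) → sumTo n (λ k → f k + g k) ≈ sumTo n f + sumTo n g
  sumTo-distrib-+ zero    f g = refl
  sumTo-distrib-+ (suc n) f g = trans (+-congʳ (sumTo-distrib-+ n f g)) (interchange _ _ _ _)

  *-distribˡ-sumTo : ∀ n x (f : ℕ → Carrier) → x * sumTo n f ≈ sumTo n (λ k → x * f k)
  *-distribˡ-sumTo zero    x f = refl
  *-distribˡ-sumTo (suc n) x f = trans (distribˡ x _ _) (+-congʳ (*-distribˡ-sumTo n x f))

  *-distribʳ-sumTo : ∀ n x (f : ℕ → Carrier) → sumTo n f * x ≈ sumTo n (λ k → f k * x)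
  *-distribʳ-sumTo zero    x f = refl
  *-distribʳ-sumTo (suc n) x f = trans (distribʳ x _ _) (+-congʳ (*-distribʳ-sumTo n x f))

  sumTo-unfoldˡ : ∀ n (f : ℕ → Carrier) → sumTo (suc n) f ≈ f 0 + sumTo n (λ k → f (suc k))
  sumTo-unfoldˡ zero    f = refl
  sumTo-unfoldˡ (suc n) f = trans (+-congʳ (sumTo-unfoldˡ n f)) (+-assoc _ _ _)

  sumTo-comm : ∀ n m (f : ℕ → ℕ → Carrier) →
               sumTo n (λ i → sumTo m (f i)) ≈ sumTo m (λ k → sumTo n (λ i → f i k))
  sumTo-comm zero    m f = refl
  sumTo-comm (suc n) m f =
    trans (+-congʳ (sumTo-comm n m f)) (sym (sumTo-distrib-+ m (λ k → sumTo n (λ i → f i k)) (f (suc n))))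

  sumTo-extend : ∀ {n m} (f : ℕ → Carrier) → n ≤ m → (∀ k → n < k → f k ≈ 0#) → sumTo m f ≈ sumTo n f
  sumTo-extend {n} f n≤m tail≈0 = go (≤⇒≤′ n≤m)
    where
      go : ∀ {m} → n ≤′ m → sumTo m f ≈ sumTo n f
      go (≤′-reflexive ≡.refl) = refl
      go (≤′-step n≤′m)        =
        trans (+-cong (go n≤′m) (tail≈0 _ (s≤s (≤′⇒≤ n≤′m)))) (+-identityʳ _)

  sumTo-single : ∀ n i (f : ℕ → Carrier) → i ≤ n → (∀ k → ¬ k ≡.≡ i → f k ≈ 0#) → sumTo n f ≈ f i
  sumTo-single zero    .zero f z≤n others≈0 = refl
  sumTo-single (suc n) i     f i≤1+n others≈0 with i ≟ suc n
  ... | yes ≡.refl =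
    trans (+-congʳ (sumTo-vanishing n (λ k k≤n → others≈0 k (<⇒≢ (s≤s k≤n))))) (+-identityˡ _)
  ... | no i≢1+n   =
    trans (+-cong (sumTo-single n i f (≤-pred (≤∧≢⇒< i≤1+n i≢1+n)) others≈0)
                  (others≈0 (suc n) (λ eq → i≢1+n (≡.sym eq))))
          (+-identityʳ _)

  fromℕ-+ : ∀ m n → fromℕ (m +ℕ n) ≈ fromℕ m + fromℕ n
  fromℕ-+ zero    n = sym (+-identityˡ _)
  fromℕ-+ (suc m) n = trans (+-congˡ (fromℕ-+ m n)) (sym (+-assoc _ _ _))

  -- The product of exponential series

  ∂ : ESeries → ESeries
  ∂ F n = F (suc n)

  infixl 6 _⊕_
  _⊕_ : ESeries → ESeries → ESeries
  (F ⊕ G) n = F n + G n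

  𝟙 : ESeries
  𝟙 zero    = 1#
  𝟙 (suc n) = 0#

  -- Defined by the Leibniz rule ∂(F G) = ∂F · G + F · ∂G, which makes the
  -- ring laws provable by plain induction on the degree.
  infixl 7 _⊛_
  _⊛_ : ESeries → ESeries → ESeries
  (F ⊛ G) zero    = F 0 * G 0
  (F ⊛ G) (suc n) = (∂ F ⊛ G) n + (F ⊛ ∂ G) n

  ⊛-cong-≤ : ∀ n {F F′ G G′} → (∀ m → m ≤ n → F m ≈ F′ m) → (∀ m → m ≤ n → G m ≈ G′ m) →
             (F ⊛ G) n ≈ (F′ ⊛ G′) n
  ⊛-cong-≤ zero    F≈ G≈ = *-cong (F≈ 0 z≤n) (G≈ 0 z≤n)
  ⊛-cong-≤ (suc n) F≈ G≈ =
    +-cong (⊛-cong-≤ n (λ m m≤n → F≈ (suc m) (s≤s m≤n)) (λ m m≤n → G≈ m (m≤n⇒m≤1+n m≤n)))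
           (⊛-cong-≤ n (λ m m≤n → F≈ m (m≤n⇒m≤1+n m≤n)) (λ m m≤n → G≈ (suc m) (s≤s m≤n)))

  ⊛-cong : ∀ n {F F′ G G′} → (∀ m → F m ≈ F′ m) → (∀ m → G m ≈ G′ m) → (F ⊛ G) n ≈ (F′ ⊛ G′) n
  ⊛-cong n F≈ G≈ = ⊛-cong-≤ n (λ m _ → F≈ m) (λ m _ → G≈ m)

  ⊛-comm : ∀ n F G → (F ⊛ G) n ≈ (G ⊛ F) n
  ⊛-comm zero    F G = *-comm _ _
  ⊛-comm (suc n) F G = trans (+-cong (⊛-comm n (∂ F) G) (⊛-comm n F (∂ G))) (+-comm _ _)

  ⊛-vanishingʳ : ∀ n F G → (∀ m → m ≤ n → G m ≈ 0#) → (F ⊛ G) n ≈ 0#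
  ⊛-vanishingʳ zero    F G G≈0 = trans (*-congˡ (G≈0 0 z≤n)) (zeroʳ _)
  ⊛-vanishingʳ (suc n) F G G≈0 =
    trans (+-cong (⊛-vanishingʳ n (∂ F) G (λ m m≤n → G≈0 m (m≤n⇒m≤1+n m≤n)))
                  (⊛-vanishingʳ n F (∂ G) (λ m m≤n → G≈0 (suc m) (s≤s m≤n))))
          (+-identityʳ 0#)

  ⊛-identityˡ : ∀ n F → (𝟙 ⊛ F) n ≈ F n
  ⊛-identityˡ zero    F = *-identityˡ _
  ⊛-identityˡ (suc n) F =
    trans (+-cong (trans (⊛-comm n (∂ 𝟙) F) (⊛-vanishingʳ n F (∂ 𝟙) (λ _ _ → refl))) (⊛-identityˡ n (∂ F)))
          (+-identityˡ _)

  ⊛-distribˡ-⊕ : ∀ n F G K → (F ⊛ (G ⊕ K)) n ≈ (F ⊛ G) n + (F ⊛ K) n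
  ⊛-distribˡ-⊕ zero    F G K = distribˡ _ _ _
  ⊛-distribˡ-⊕ (suc n) F G K =
    trans (+-cong (⊛-distribˡ-⊕ n (∂ F) G K) (⊛-distribˡ-⊕ n F (∂ G) (∂ K))) (interchange _ _ _ _)

  ⊛-distribʳ-⊕ : ∀ n F G K → ((G ⊕ K) ⊛ F) n ≈ (G ⊛ F) n + (K ⊛ F) n
  ⊛-distribʳ-⊕ n F G K =
    trans (⊛-comm n (G ⊕ K) F) (trans (⊛-distribˡ-⊕ n F G K) (+-cong (⊛-comm n F G) (⊛-comm n F K)))

  ⊛-scalarʳ : ∀ n x F G → (F ⊛ (λ m → x * G m)) n ≈ x * (F ⊛ G) n
  ⊛-scalarʳ zero    x F G = x*yz≈y*xz _ _ _
  ⊛-scalarʳ (suc n) x F G = trans (+-cong (⊛-scalarʳ n x (∂ F) G) (⊛-scalarʳ n x F (∂ G))) (sym (distribˡ _ _ _))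

  ⊛-assoc : ∀ n F G K → ((F ⊛ G) ⊛ K) n ≈ (F ⊛ (G ⊛ K)) n
  ⊛-assoc zero    F G K = *-assoc _ _ _
  ⊛-assoc (suc n) F G K = begin
    ((∂ F ⊛ G ⊕ F ⊛ ∂ G) ⊛ K) n + ((F ⊛ G) ⊛ ∂ K) n
      ≈⟨ +-congʳ (⊛-distribʳ-⊕ n K (∂ F ⊛ G) (F ⊛ ∂ G)) ⟩
    (((∂ F ⊛ G) ⊛ K) n + ((F ⊛ ∂ G) ⊛ K) n) + ((F ⊛ G) ⊛ ∂ K) n
      ≈⟨ +-cong (+-cong (⊛-assoc n (∂ F) G K) (⊛-assoc n F (∂ G) K)) (⊛-assoc n F G (∂ K)) ⟩
    ((∂ F ⊛ (G ⊛ K)) n + (F ⊛ (∂ G ⊛ K)) n) + (F ⊛ (G ⊛ ∂ K)) n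
      ≈⟨ +-assoc _ _ _ ⟩
    (∂ F ⊛ (G ⊛ K)) n + ((F ⊛ (∂ G ⊛ K)) n + (F ⊛ (G ⊛ ∂ K)) n)
      ≈⟨ +-congˡ (sym (⊛-distribˡ-⊕ n F (∂ G ⊛ K) (G ⊛ ∂ K))) ⟩
    (∂ F ⊛ (G ⊛ K)) n + (F ⊛ (∂ G ⊛ K ⊕ G ⊛ ∂ K)) n
      ∎

  ⊛-leftComm : ∀ n F G K → (F ⊛ (G ⊛ K)) n ≈ (G ⊛ (F ⊛ K)) n
  ⊛-leftComm n F G K =
    trans (sym (⊛-assoc n F G K)) (trans (⊛-cong n (λ m → ⊛-comm m F G) (λ _ → refl)) (⊛-assoc n G F K))

  ⊛-distribˡ-sumTo : ∀ k n F (G : ℕ → ESeries) →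
                     sumTo k (λ i → (F ⊛ G i) n) ≈ (F ⊛ (λ m → sumTo k (λ i → G i m))) n
  ⊛-distribˡ-sumTo zero    n F G = refl
  ⊛-distribˡ-sumTo (suc k) n F G =
    trans (+-congʳ (⊛-distribˡ-sumTo k n F G)) (sym (⊛-distribˡ-⊕ n F (λ m → sumTo k (λ i → G i m)) (G (suc k))))

  binomialProduct : ESeries → ESeries → ESeries
  binomialProduct F G n = sumTo n (λ i → fromℕ (n C i) * (F i * G (n ∸ i)))

  binomialProduct-leibniz : ∀ n F G →
    binomialProduct F G (suc n) ≈ binomialProduct (∂ F) G n + binomialProduct F (∂ G) n
  binomialProduct-leibniz n F G = begin
    binomialProduct F G (suc n)
      ≈⟨ sumTo-unfoldˡ n _ ⟩
    T 0 + sumTo n (λ i → fromℕ (suc n C suc i) * (F (suc i) * G (n ∸ i)))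
      ≈⟨ +-congˡ (sumTo-cong n (λ i _ → pascal i)) ⟩
    T 0 + sumTo n (λ i → fromℕ (n C i) * (F (suc i) * G (n ∸ i)) + T (suc i))
      ≈⟨ +-congˡ (sumTo-distrib-+ n _ _) ⟩
    T 0 + (binomialProduct (∂ F) G n + sumTo n (λ i → T (suc i)))
      ≈⟨ x∙yz≈y∙xz _ _ _ ⟩
    binomialProduct (∂ F) G n + (T 0 + sumTo n (λ i → T (suc i)))
      ≈⟨ +-congˡ (sym (sumTo-unfoldˡ n T)) ⟩
    binomialProduct (∂ F) G n + sumTo (suc n) T
      ≈⟨ +-congˡ (sumTo-extend T (n≤1+n n) (λ k n<k → trans (*-congʳ (reflexive (≡.cong fromℕ (k>n⇒nCk≡0 n<k)))) (zeroˡ _))) ⟩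
    binomialProduct (∂ F) G n + sumTo n T
      ≈⟨ +-congˡ (sumTo-cong n (λ i i≤n → *-congˡ (*-congˡ (reflexive (≡.cong G (+-∸-assoc 1 i≤n)))))) ⟩
    binomialProduct (∂ F) G n + binomialProduct F (∂ G) n
      ∎
    where
      T : ℕ → Carrier
      T i = fromℕ (n C i) * (F i * G (suc n ∸ i))

      pascal : ∀ i → fromℕ (suc n C suc i) * (F (suc i) * G (n ∸ i))
                   ≈ fromℕ (n C i) * (F (suc i) * G (n ∸ i)) + T (suc i)
      pascal i = trans (*-congʳ (trans (reflexive (≡.cong fromℕ (≡.sym (nCk+nC[k+1]≡[n+1]C[k+1] n i))))
                                       (fromℕ-+ (n C i) (n C suc i))))
                       (distribʳ _ _ _)

  binomialProduct≈⊛ : ∀ n F G → binomialProduct F G n ≈ (F ⊛ G) n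
  binomialProduct≈⊛ zero    F G = trans (*-congʳ (+-identityʳ 1#)) (*-identityˡ _)
  binomialProduct≈⊛ (suc n) F G =
    trans (binomialProduct-leibniz n F G) (+-cong (binomialProduct≈⊛ n (∂ F) G) (binomialProduct≈⊛ n F (∂ G)))

  divPow-suc : ∀ k H n → divPow (suc k) H (suc n) ≈ (∂ H ⊛ divPow k H) n
  divPow-suc k H n = binomialProduct≈⊛ n (∂ H) (divPow k H)

  divPow-vanishing : ∀ k H n → n < k → divPow k H n ≈ 0#
  divPow-vanishing (suc k) H zero    _         = refl
  divPow-vanishing (suc k) H (suc n) (s≤s n<k) =
    trans (divPow-suc k H n)
          (⊛-vanishingʳ n (∂ H) (divPow k H) (λ m m≤n → divPow-vanishing k H m (≤-<-trans m≤n n<k)))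

  divPow-cong : ∀ k {H H′} → (∀ m → H m ≈ H′ m) → ∀ n → divPow k H n ≈ divPow k H′ n
  divPow-cong zero    H≈ zero    = refl
  divPow-cong zero    H≈ (suc n) = refl
  divPow-cong (suc k) H≈ zero    = refl
  divPow-cong (suc k) H≈ (suc n) =
    sumTo-cong n (λ i _ → *-congˡ (*-cong (H≈ (suc i)) (divPow-cong k H≈ (n ∸ i))))

  divPow-zero : ∀ H n → divPow 0 H n ≈ 𝟙 n
  divPow-zero H zero    = refl
  divPow-zero H (suc n) = refl

  δ-refl : ∀ n → δ n n ≈ 1#
  δ-refl zero    = refl
  δ-refl (suc n) = δ-refl n

  δ-≢ : ∀ n k → ¬ k ≡.≡ n → δ n k ≈ 0#
  δ-≢ zero    zero    k≢n = ⊥-elim (k≢n ≡.refl)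
  δ-≢ zero    (suc k) k≢n = refl
  δ-≢ (suc n) zero    k≢n = refl
  δ-≢ (suc n) (suc k) k≢n = δ-≢ n k (λ eq → k≢n (≡.cong suc eq))

  divPow-tSeries : ∀ j n → divPow j tSeries n ≈ δ n j
  divPow-tSeries zero    zero    = refl
  divPow-tSeries zero    (suc n) = refl
  divPow-tSeries (suc j) zero    = refl
  divPow-tSeries (suc j) (suc n) =
    trans (divPow-suc j tSeries n)
          (trans (⊛-cong n ∂t≈𝟙 (λ _ → refl)) (trans (⊛-identityˡ n _) (divPow-tSeries j n)))
    where
      ∂t≈𝟙 : ∀ m → ∂ tSeries m ≈ 𝟙 m
      ∂t≈𝟙 zero    = refl
      ∂t≈𝟙 (suc m) = refl

  -- Composition

  compose-extend : ∀ F H {n m} → n ≤ m → sumTo m (λ k → F k * divPow k H n) ≈ compose F H n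
  compose-extend F H n≤m =
    sumTo-extend _ n≤m (λ k n<k → trans (*-congˡ (divPow-vanishing k H _ n<k)) (zeroʳ _))

  compose-congˡ : ∀ {F F′} H → (∀ m → F m ≈ F′ m) → ∀ n → compose F H n ≈ compose F′ H n
  compose-congˡ H F≈ n = sumTo-cong n (λ k _ → *-congʳ (F≈ k))

  compose-congʳ : ∀ F {H H′} → (∀ m → H m ≈ H′ m) → ∀ n → compose F H n ≈ compose F H′ n
  compose-congʳ F H≈ n = sumTo-cong n (λ k _ → *-congˡ (divPow-cong k H≈ n))

  compose-distribʳ-⊕ : ∀ F G H n → compose (F ⊕ G) H n ≈ compose F H n + compose G H n
  compose-distribʳ-⊕ F G H n = trans (sumTo-cong n (λ k _ → distribʳ _ _ _)) (sumTo-distrib-+ n _ _)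

  compose-chainRule : ∀ F H n → compose F H (suc n) ≈ (∂ H ⊛ compose (∂ F) H) n
  compose-chainRule F H n = begin
    compose F H (suc n)
      ≈⟨ sumTo-unfoldˡ n _ ⟩
    F 0 * 0# + sumTo n (λ k → F (suc k) * divPow (suc k) H (suc n))
      ≈⟨ trans (+-congʳ (zeroʳ _)) (+-identityˡ _) ⟩
    sumTo n (λ k → F (suc k) * divPow (suc k) H (suc n))
      ≈⟨ sumTo-cong n (λ k _ → trans (*-congˡ (divPow-suc k H n)) (sym (⊛-scalarʳ n (F (suc k)) (∂ H) (divPow k H)))) ⟩
    sumTo n (λ k → (∂ H ⊛ (λ m → F (suc k) * divPow k H m)) n)
      ≈⟨ ⊛-distribˡ-sumTo n n (∂ H) (λ k m → F (suc k) * divPow k H m) ⟩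
    (∂ H ⊛ (λ m → sumTo n (λ k → F (suc k) * divPow k H m))) n
      ≈⟨ ⊛-cong-≤ n (λ _ _ → refl) (λ m m≤n → compose-extend (∂ F) H m≤n) ⟩
    (∂ H ⊛ compose (∂ F) H) n
      ∎

  ComposeMultiplicative : ESeries → ℕ → Set (c ⊔ ℓ)
  ComposeMultiplicative H n = ∀ F G → compose (F ⊛ G) H n ≈ (compose F H ⊛ compose G H) n

  compose-⊛ : ∀ H n → ComposeMultiplicative H n
  compose-⊛ H = <-rec (ComposeMultiplicative H) step
    where
      step : ∀ n → (∀ {m} → m < n → ComposeMultiplicative H m) → ComposeMultiplicative H n
      step zero    _  F G = trans (*-identityʳ _) (sym (*-cong (*-identityʳ _) (*-identityʳ _)))
      step (suc n) IH F G = begin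
        compose (F ⊛ G) H (suc n)
          ≈⟨ compose-chainRule (F ⊛ G) H n ⟩
        (∂ H ⊛ compose (∂ F ⊛ G ⊕ F ⊛ ∂ G) H) n
          ≈⟨ ⊛-cong-≤ n (λ _ _ → refl) (λ m m≤n → trans (compose-distribʳ-⊕ (∂ F ⊛ G) (F ⊛ ∂ G) H m)
                                                         (+-cong (IH (s≤s m≤n) (∂ F) G) (IH (s≤s m≤n) F (∂ G)))) ⟩
        (∂ H ⊛ (F′∘H ⊛ G∘H ⊕ F∘H ⊛ G′∘H)) n
          ≈⟨ ⊛-distribˡ-⊕ n (∂ H) (F′∘H ⊛ G∘H) (F∘H ⊛ G′∘H) ⟩
        (∂ H ⊛ (F′∘H ⊛ G∘H)) n + (∂ H ⊛ (F∘H ⊛ G′∘H)) n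
          ≈⟨ +-cong (sym (⊛-assoc n (∂ H) F′∘H G∘H)) (⊛-leftComm n (∂ H) F∘H G′∘H) ⟩
        ((∂ H ⊛ F′∘H) ⊛ G∘H) n + (F∘H ⊛ (∂ H ⊛ G′∘H)) n
          ≈⟨ sym (+-cong (⊛-cong n (compose-chainRule F H) (λ _ → refl))
                         (⊛-cong n (λ _ → refl) (compose-chainRule G H))) ⟩
        (F∘H ⊛ G∘H) (suc n)
          ∎
        where
          F∘H F′∘H G∘H G′∘H : ESeries
          F∘H  = compose F H
          F′∘H = compose (∂ F) H
          G∘H  = compose G H
          G′∘H = compose (∂ G) H

  divPow-compose : ∀ j G H n → divPow j (compose G H) n ≈ compose (divPow j G) H n
  divPow-compose zero    G H zero    = sym (*-identityˡ _)
  divPow-compose zero    G H (suc n) = sym (sumTo-vanishing (suc n) (λ { zero _ → zeroʳ _ ; (suc k) _ → zeroˡ _ }))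
  divPow-compose (suc j) G H zero    = sym (zeroˡ _)
  divPow-compose (suc j) G H (suc n) = begin
    divPow (suc j) (compose G H) (suc n)
      ≈⟨ divPow-suc j (compose G H) n ⟩
    (∂ (compose G H) ⊛ divPow j (compose G H)) n
      ≈⟨ ⊛-cong n (compose-chainRule G H) (divPow-compose j G H) ⟩
    ((∂ H ⊛ compose (∂ G) H) ⊛ compose (divPow j G) H) n
      ≈⟨ ⊛-assoc n _ _ _ ⟩
    (∂ H ⊛ (compose (∂ G) H ⊛ compose (divPow j G) H)) n
      ≈˘⟨ ⊛-cong n (λ _ → refl) (λ m → compose-⊛ H m (∂ G) (divPow j G)) ⟩
    (∂ H ⊛ compose (∂ G ⊛ divPow j G) H) n
      ≈˘⟨ ⊛-cong n (λ _ → refl) (compose-congˡ H (divPow-suc j G)) ⟩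
    (∂ H ⊛ compose (∂ (divPow (suc j) G)) H) n
      ≈˘⟨ compose-chainRule (divPow (suc j) G) H n ⟩
    compose (divPow (suc j) G) H (suc n)
      ∎

  compose-assoc : ∀ F G H n → compose F (compose G H) n ≈ compose (compose F G) H n
  compose-assoc F G H n = begin
    sumTo n (λ j → F j * divPow j (compose G H) n)
      ≈⟨ sumTo-cong n (λ j _ → trans (*-congˡ (divPow-compose j G H n)) (*-distribˡ-sumTo n (F j) _)) ⟩
    sumTo n (λ j → sumTo n (λ k → F j * (divPow j G k * divPow k H n)))
      ≈⟨ sumTo-comm n n _ ⟩
    sumTo n (λ k → sumTo n (λ j → F j * (divPow j G k * divPow k H n)))
      ≈˘⟨ sumTo-cong n (λ k _ → trans (*-distribʳ-sumTo n (divPow k H n) _) (sumTo-cong n (λ j _ → *-assoc _ _ _))) ⟩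
    sumTo n (λ k → sumTo n (λ j → F j * divPow j G k) * divPow k H n)
      ≈⟨ sumTo-cong n (λ k k≤n → *-congʳ (compose-extend F G k≤n)) ⟩
    sumTo n (λ k → compose F G k * divPow k H n)
      ∎

  compose-identityʳ : ∀ F n → compose F tSeries n ≈ F n
  compose-identityʳ F n = begin
    sumTo n (λ k → F k * divPow k tSeries n)
      ≈⟨ sumTo-cong n (λ k _ → *-congˡ (divPow-tSeries k n)) ⟩
    sumTo n (λ k → F k * δ n k)
      ≈⟨ sumTo-single n n _ ≤-refl (λ k k≢n → trans (*-congˡ (δ-≢ n k k≢n)) (zeroʳ _)) ⟩
    F n * δ n n
      ≈⟨ trans (*-congˡ (δ-refl n)) (*-identityʳ _) ⟩
    F n
      ∎

  compose-identityˡ : ∀ H → H 0 ≈ 0# → ∀ n → compose tSeries H n ≈ H n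
  compose-identityˡ H H₀≈0 zero    = trans (zeroˡ _) (sym H₀≈0)
  compose-identityˡ H H₀≈0 (suc n) = begin
    compose tSeries H (suc n)
      ≈⟨ sumTo-single (suc n) 1 _ (s≤s z≤n) others≈0 ⟩
    1# * divPow 1 H (suc n)
      ≈⟨ trans (*-identityˡ _) (divPow-suc 0 H n) ⟩
    (∂ H ⊛ divPow 0 H) n
      ≈⟨ trans (⊛-cong n (λ _ → refl) (divPow-zero H)) (⊛-comm n (∂ H) 𝟙) ⟩
    (𝟙 ⊛ ∂ H) n
      ≈⟨ ⊛-identityˡ n (∂ H) ⟩
    H (suc n)
      ∎
    where
      others≈0 : ∀ k → ¬ k ≡.≡ 1 → tSeries k * divPow k H (suc n) ≈ 0#
      others≈0 zero          _   = zeroˡ _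
      others≈0 (suc zero)    k≢1 = ⊥-elim (k≢1 ≡.refl)
      others≈0 (suc (suc k)) _   = zeroˡ _

  leftInverse≈rightInverse : ∀ {F H H′} → H 0 ≈ 0# →
    (∀ n → compose F H n ≈ tSeries n) → (∀ n → compose H′ F n ≈ tSeries n) → ∀ n → H′ n ≈ H n
  leftInverse≈rightInverse {F} {H} {H′} H₀≈0 F∘H≈t H′∘F≈t n = begin
    H′ n                        ≈˘⟨ compose-identityʳ H′ n ⟩
    compose H′ tSeries n        ≈˘⟨ compose-congʳ H′ F∘H≈t n ⟩
    compose H′ (compose F H) n  ≈⟨ compose-assoc H′ F H n ⟩
    compose (compose H′ F) H n  ≈⟨ compose-congˡ H H′∘F≈t n ⟩
    compose tSeries H n         ≈⟨ compose-identityˡ H H₀≈0 n ⟩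
    H n                         ∎

  minus1-plus1 : ∀ H → H 0 ≈ 0# → ∀ n → minus1 (plus1 H) n ≈ H n
  minus1-plus1 H H₀≈0 zero    = sym H₀≈0
  minus1-plus1 H H₀≈0 (suc n) = refl

  -- The coefficient of t^n/n! in (G^j/j!) ∘ H, read off in two ways.
  divPow-compInverse : ∀ {G H} → (∀ n → compose G H n ≈ tSeries n) →
    ∀ n j → sumTo n (λ k → divPow k H n * divPow j G k) ≈ δ n j
  divPow-compInverse {G} {H} G∘H≈t n j = begin
    sumTo n (λ k → divPow k H n * divPow j G k)  ≈⟨ sumTo-cong n (λ k _ → *-comm _ _) ⟩
    compose (divPow j G) H n                     ≈˘⟨ divPow-compose j G H n ⟩
    divPow j (compose G H) n                     ≈⟨ divPow-cong j G∘H≈t n ⟩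
    divPow j tSeries n                           ≈⟨ divPow-tSeries j n ⟩
    δ n j                                        ∎

corollary6p1 : ∀ {c ℓ} (R : CommutativeRing c ℓ) →
  let open CommutativeRing R
      open Umbral R
  in IsIntegralDomain → CharZero →
     (a : ESeries) → a 0 ≈ 1# →
     ¬ (a 1 ≈ 0#) →
     (h : ESeries) → IsCompInverse (minus1 a) h →
     (q p : PolySeq) →
     IsAssociated a q →
     IsAssociated (plus1 h) p →
     ∀ n j → sumTo n (λ k → q n k * p k j) ≈ δ n j
-- The domain and characteristic hypotheses and E[γ] ≠ 0 only serve to make
-- the compositional inverse exist; here it is given.
corollary6p1 R _ _ a _ _ h (h₀≈0 , f∘h≈t , _) q p (h′ , (_ , _ , h′∘f≈t) , q≈) (g , (_ , _ , g∘h≈t) , p≈) n j =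
  begin
    sumTo n (λ k → q n k * p k j)                 ≈⟨ sumTo-cong n (λ k _ → *-cong (q≈ n k) (p≈ k j)) ⟩
    sumTo n (λ k → divPow k h′ n * divPow j g k)  ≈⟨ divPow-compInverse g∘h′≈t n j ⟩
    δ n j                                         ∎
  where
    open CommutativeRing R
    open Umbral R
    open ExponentialSeries R
    open SetoidReasoning setoid

    h′≈minus1-plus1-h : ∀ m → h′ m ≈ minus1 (plus1 h) m
    h′≈minus1-plus1-h m = trans (leftInverse≈rightInverse h₀≈0 f∘h≈t h′∘f≈t m) (sym (minus1-plus1 h h₀≈0 m))

    g∘h′≈t : ∀ m → compose g h′ m ≈ tSeries m
    g∘h′≈t m = trans (compose-congʳ g h′≈minus1-plus1-h m) (g∘h≈t m)
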